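{- For every positive integer $n$, as polynomials in $t$, $$\sum_{\substack{\mathbf p=(p_1,\dots,p_l),\ p_i\in\{1,2\}\\ p_1+\dots+p_l=n}}\frac{(n-1)!}{s_{\mathbf p}}\,\frac{(n-1)!}{s_{\mathbf p'}}\,t^{n-l}=\prod_{k}(1+k^2t),$$ where the sum is over all compositions of $n$ all of whose parts are $1$ or $2$, the product is over all positive integers $k$ in the list $n-1,n-3,n-5,\dots$, $s_{\mathbf p}=\prod_{j=1}^{l-1}(p_1+\dots+p_j)$, and $\mathbf p'=(p_l,\dots,p_1)$ is the reversed composition.
   Context: A composition of $n$ is an ordered list of positive integers summing to $n$ (of any length $l\ge1$). Empty products equal $1$. -}

module Defs where

open import Data.Nat using (ℕ; zero; suc; _+_; _*_; _∸_; _!)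
open import Data.Integer using (+_)
open import Data.Rational using (ℚ; 0ℚ; 1ℚ; _/_) renaming (_+_ to _+ℚ_; _*_ to _*ℚ_)
open import Data.List using (List; []; _∷_; [_]; _++_; map; foldr; length; take; reverse; replicate)
open import Data.Nat.ListAction using (product)

-- Polynomials in t with rational coefficients, as coefficient lists
-- (lowest degree first).  Two polynomials are equal iff all coefficients agree.
Poly : Set
Poly = List ℚ

coeff : Poly → ℕ → ℚ
coeff []       _       = 0ℚ
coeff (c ∷ cs) zero    = c
coeff (c ∷ cs) (suc m) = coeff cs m

_+P_ : Poly → Poly → Poly
[]       +P q        = q
(c ∷ cs) +P []       = c ∷ cs
(c ∷ cs) +P (d ∷ ds) = (c +ℚ d) ∷ (cs +P ds)

scaleP : ℚ → Poly → Poly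
scaleP a = map (a *ℚ_)

_*P_ : Poly → Poly → Poly
[]       *P q = []
(c ∷ cs) *P q = scaleP c q +P (0ℚ ∷ (cs *P q))

monomial : ℚ → ℕ → Poly
monomial c d = replicate d 0ℚ ++ [ c ]

sumP : List Poly → Poly
sumP = foldr _+P_ []

prodP : List Poly → Poly
prodP = foldr _*P_ [ 1ℚ ]

comps12 : ℕ → List (List ℕ)
comps12 zero          = [ [] ]
comps12 (suc zero)    = [ 1 ∷ [] ]
comps12 (suc (suc n)) = map (1 ∷_) (comps12 (suc n)) ++ map (2 ∷_) (comps12 n)

partialSums : ℕ → List ℕ → List ℕ
partialSums acc []       = []
partialSums acc (x ∷ xs) = (acc + x) ∷ partialSums (acc + x) xs

s : List ℕ → ℕ
s p = product (take (length p ∸ 1) (partialSums 0 p))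

-- a / b as a rational; only ever used with b > 0 (the b = 0 case is a dummy)
frac : ℕ → ℕ → ℚ
frac a zero    = 0ℚ
frac a (suc b) = (+ a) / suc b

lhs : ℕ → Poly
lhs n = sumP (map (λ p → monomial (frac ((n ∸ 1) !) (s p) *ℚ frac ((n ∸ 1) !) (s (reverse p))) (n ∸ length p)) (comps12 n))

downBy2 : ℕ → List ℕ
downBy2 zero          = []
downBy2 (suc zero)    = [ 1 ]
downBy2 (suc (suc k)) = suc (suc k) ∷ downBy2 k

rhs : ℕ → Poly
rhs n = prodP (map (λ k → 1ℚ ∷ [ (+ (k * k)) / 1 ]) (downBy2 (n ∸ 1)))

-- For a composition p of n into parts 1 and 2, the integers in 1 … n - 1 that are not partial
-- sums of p are the j with a part 2 covering {j, j + 1}, and for the reversed composition they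
-- are the n - j.  Hence ((n - 1)! / s p) ((n - 1)! / s p') t^(n - l) is the product of j (n - j) t
-- over these parts, and the left side is the matching polynomial of the path 1 … n whose edge
-- {j, j + 1} has weight j (n - j) t.  Let M(a, m) be the matching polynomial of the path on m
-- vertices whose i-th edge has weight (a + 1 + i) (m - 1 - i) t.  Expanding along the first edge
-- and inducting on m gives M(a + 2, m) = M(a, m) + m (m - 1) t M(a + 2, m - 2) for every integer a.
-- At a = -2 the first edge has weight -(m - 1) and the second weight 0, so
-- M(-2, m) = (1 - (m - 1) t) M(0, m - 2), and the identity becomes
-- M(0, m) = (1 + (m - 1)² t) M(0, m - 2), which unfolds into the product.

module Submission where

open import Defs
open import Data.Nat using (ℕ; zero; suc; _≤_)
open import Data.Nat.ListAction using (sum; product)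
open import Data.Integer using (ℤ; +_; -[1+_]; 0ℤ; 1ℤ)
open import Data.Rational using (ℚ; 0ℚ; 1ℚ; _/_; toℚᵘ) renaming (_+_ to _+ℚ_; _*_ to _*ℚ_)
open import Data.Rational.Unnormalised using (mkℚᵘ; *≡*) renaming (_≃_ to _≃ᵘ_; _+_ to _+ᵘ_; _*_ to _*ᵘ_)
open import Data.List using (List; []; _∷_; [_]; _++_; _∷ʳ_; map; length; take; reverse)
open import Data.List.Properties using (map-++; map-∘; unfold-reverse)
open import Data.List.Relation.Unary.All using (All; []; _∷_)
open import Data.Empty using (⊥-elim)
open import Function using (_∘_)
open import Relation.Binary.PropositionalEquality
  using (_≡_; _≗_; refl; sym; trans; cong; cong₂; module ≡-Reasoning)
import Data.Nat as ℕ
import Data.Nat.Properties as ℕ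
import Data.Integer as ℤ
import Data.Integer.Properties as ℤ
import Data.Rational.Properties as ℚ
import Data.Rational.Unnormalised.Properties as ℚᵘ
import Data.List.Relation.Unary.All as All
import Data.List.Relation.Unary.All.Properties as All

module Compositions where

  open import Data.Nat using (_+_; _*_; _∸_; _!)
  open import Data.Nat.Properties using (+-comm; +-suc; +-identityʳ; *-identityˡ; *-identityʳ; m+n∸m≡n)
  open import Data.Nat.ListAction.Properties using (sum-↭)
  open import Data.List.Relation.Binary.Permutation.Propositional.Properties using (↭-reverse)
  open import Data.Nat.Tactic.RingSolver using (solve-∀)
  open ≡-Reasoning

  data Comp12 : ℕ → List ℕ → Set where
    []  : Comp12 0 []
    1∷_ : ∀ {m p} → Comp12 m p → Comp12 (suc m) (1 ∷ p)
    2∷_ : ∀ {m p} → Comp12 m p → Comp12 (suc (suc m)) (2 ∷ p)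

  comps12-sound : ∀ m → All (Comp12 m) (comps12 m)
  comps12-sound zero          = [] ∷ []
  comps12-sound (suc zero)    = (1∷ []) ∷ []
  comps12-sound (suc (suc m)) =
    All.++⁺ (All.map⁺ (All.map 1∷_ (comps12-sound (suc m))))
            (All.map⁺ (All.map 2∷_ (comps12-sound m)))

  Comp12-sum : ∀ {m p} → Comp12 m p → sum p ≡ m
  Comp12-sum []     = refl
  Comp12-sum (1∷ c) = cong suc (Comp12-sum c)
  Comp12-sum (2∷ c) = cong (suc ∘ suc) (Comp12-sum c)

  twos : List ℕ → ℕ
  twos []      = 0
  twos (2 ∷ p) = suc (twos p)
  twos (_ ∷ p) = twos p

  Comp12-length+twos : ∀ {m p} → Comp12 m p → length p + twos p ≡ m
  Comp12-length+twos []     = refl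
  Comp12-length+twos (1∷ c) = cong suc (Comp12-length+twos c)
  Comp12-length+twos (2∷_ {p = p} c) =
    cong suc (trans (+-suc (length p) (twos p)) (cong suc (Comp12-length+twos c)))

  Comp12-∸length≡twos : ∀ {m p} → Comp12 m p → m ∸ length p ≡ twos p
  Comp12-∸length≡twos {p = p} c =
    trans (cong (_∸ length p) (sym (Comp12-length+twos c))) (m+n∸m≡n (length p) (twos p))

  s⟨_⟩ : ℕ → List ℕ → ℕ
  s⟨ a ⟩ p = product (take (length p ∸ 1) (partialSums a p))

  s⟨⟩-∷ : ∀ {m q} a x → Comp12 (suc m) q → s⟨ a ⟩ (x ∷ q) ≡ (x + a) * s⟨ x + a ⟩ q
  s⟨⟩-∷ {q = q} a x (1∷ _) = cong (λ b → b * s⟨ b ⟩ q) (+-comm a x)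
  s⟨⟩-∷ {q = q} a x (2∷ _) = cong (λ b → b * s⟨ b ⟩ q) (+-comm a x)

  -- A part 2 starting after a contributes a + 1 to (n - 1)! / s p and n - a - 1 to
  -- (n - 1)! / s p'; the latter is m - 1 when the parts still to come sum to m = n - a.
  gapProduct : ℕ → List ℕ → ℕ
  gapProduct a []      = 1
  gapProduct a (1 ∷ p) = gapProduct (suc a) p
  gapProduct a (2 ∷ p) = suc a * gapProduct (suc (suc a)) p
  gapProduct a (_ ∷ p) = 0

  gapProductʳ : ℕ → List ℕ → ℕ
  gapProductʳ n             []      = 1
  gapProductʳ (suc n)       (1 ∷ p) = gapProductʳ n p
  gapProductʳ (suc (suc n)) (2 ∷ p) = suc n * gapProductʳ n p
  gapProductʳ _             _       = 0

  a!*s⟨a⟩*gap≡[a+m]! : ∀ {m p} a → Comp12 (suc m) p → a ! * (s⟨ a ⟩ p * gapProduct a p) ≡ (a + m) !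
  a!*s⟨a⟩*gap≡[a+m]! a (1∷ []) = trans (*-identityʳ (a !)) (cong _! (sym (+-identityʳ a)))
  a!*s⟨a⟩*gap≡[a+m]! a (1∷_ {suc m} {q} c) = begin
    a ! * (s⟨ a ⟩ (1 ∷ q) * G)
      ≡⟨ cong (λ x → a ! * (x * G)) (s⟨⟩-∷ a 1 c) ⟩
    a ! * ((suc a * s⟨ suc a ⟩ q) * G)
      ≡⟨ ring (a !) (suc a) (s⟨ suc a ⟩ q) G ⟩
    suc a ! * (s⟨ suc a ⟩ q * G)
      ≡⟨ a!*s⟨a⟩*gap≡[a+m]! (suc a) c ⟩
    (suc a + m) !
      ≡⟨ cong _! (+-suc a m) ⟨
    (a + suc m) ! ∎
    where
    G = gapProduct (suc a) q
    ring : ∀ f b S G → f * ((b * S) * G) ≡ (b * f) * (S * G)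
    ring = solve-∀
  a!*s⟨a⟩*gap≡[a+m]! a (2∷ []) = trans (ring (a !) a) (cong _! (+-comm 1 a))
    where
    ring : ∀ f a → f * (1 * ((1 + a) * 1)) ≡ (1 + a) * f
    ring = solve-∀
  a!*s⟨a⟩*gap≡[a+m]! a (2∷_ {suc m} {q} c) = begin
    a ! * (s⟨ a ⟩ (2 ∷ q) * (suc a * G))
      ≡⟨ cong (λ x → a ! * (x * (suc a * G))) (s⟨⟩-∷ a 2 c) ⟩
    a ! * ((suc (suc a) * s⟨ suc (suc a) ⟩ q) * (suc a * G))
      ≡⟨ ring (a !) a (s⟨ suc (suc a) ⟩ q) G ⟩
    suc (suc a) ! * (s⟨ suc (suc a) ⟩ q * G)
      ≡⟨ a!*s⟨a⟩*gap≡[a+m]! (suc (suc a)) c ⟩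
    (suc (suc a) + m) !
      ≡⟨ cong _! (trans (+-suc a (suc m)) (cong suc (+-suc a m))) ⟨
    (a + suc (suc m)) ! ∎
    where
    G = gapProduct (suc (suc a)) q
    ring : ∀ f a S G → f * (((2 + a) * S) * ((1 + a) * G)) ≡ ((2 + a) * ((1 + a) * f)) * (S * G)
    ring = solve-∀

  !≡s*gapProduct : ∀ {m p} → Comp12 (suc m) p → m ! ≡ s p * gapProduct 0 p
  !≡s*gapProduct {p = p} c = trans (sym (a!*s⟨a⟩*gap≡[a+m]! 0 c)) (*-identityˡ (s p * gapProduct 0 p))

  s⟨⟩-∷ʳ : ∀ a r z → s⟨ a ⟩ (r ∷ʳ z) ≡ product (partialSums a r)
  s⟨⟩-∷ʳ a []          z = refl
  s⟨⟩-∷ʳ a (x ∷ [])    z = refl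
  s⟨⟩-∷ʳ a (x ∷ y ∷ r) z = cong ((a + x) *_) (s⟨⟩-∷ʳ (a + x) (y ∷ r) z)

  product-partialSums-∷ʳ : ∀ a r z →
    product (partialSums a (r ∷ʳ z)) ≡ product (partialSums a r) * (a + sum (r ∷ʳ z))
  product-partialSums-∷ʳ a []      z = ring a z
    where
    ring : ∀ a z → (a + z) * 1 ≡ 1 * (a + (z + 0))
    ring = solve-∀
  product-partialSums-∷ʳ a (x ∷ r) z = begin
    (a + x) * product (partialSums (a + x) (r ∷ʳ z))
      ≡⟨ cong ((a + x) *_) (product-partialSums-∷ʳ (a + x) r z) ⟩
    (a + x) * (product (partialSums (a + x) r) * ((a + x) + sum (r ∷ʳ z)))
      ≡⟨ ring a x (product (partialSums (a + x) r)) (sum (r ∷ʳ z)) ⟩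
    ((a + x) * product (partialSums (a + x) r)) * (a + (x + sum (r ∷ʳ z))) ∎
    where
    ring : ∀ a x P S → (a + x) * (P * ((a + x) + S)) ≡ ((a + x) * P) * (a + (x + S))
    ring = solve-∀

  s-reverse-∷∷ : ∀ x y q → s (reverse (x ∷ y ∷ q)) ≡ s (reverse (y ∷ q)) * sum (y ∷ q)
  s-reverse-∷∷ x y q = begin
    s (reverse (x ∷ y ∷ q))
      ≡⟨ cong s (trans (unfold-reverse x (y ∷ q)) (cong (_∷ʳ x) (unfold-reverse y q))) ⟩
    s (reverse q ∷ʳ y ∷ʳ x)
      ≡⟨ s⟨⟩-∷ʳ 0 (reverse q ∷ʳ y) x ⟩
    product (partialSums 0 (reverse q ∷ʳ y))
      ≡⟨ product-partialSums-∷ʳ 0 (reverse q) y ⟩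
    product (partialSums 0 (reverse q)) * sum (reverse q ∷ʳ y)
      ≡⟨ cong (_* sum (reverse q ∷ʳ y)) (sym (s⟨⟩-∷ʳ 0 (reverse q) y)) ⟩
    s (reverse q ∷ʳ y) * sum (reverse q ∷ʳ y)
      ≡⟨ cong (λ r → s r * sum r) (sym (unfold-reverse y q)) ⟩
    s (reverse (y ∷ q)) * sum (reverse (y ∷ q))
      ≡⟨ cong (s (reverse (y ∷ q)) *_) (sum-↭ (↭-reverse (y ∷ q))) ⟩
    s (reverse (y ∷ q)) * sum (y ∷ q) ∎

  s-reverse-∷ : ∀ {m q} x → Comp12 (suc m) q → s (reverse (x ∷ q)) ≡ s (reverse q) * suc m
  s-reverse-∷ {q = q} x c@(1∷_ {p = r} _) =
    trans (s-reverse-∷∷ x 1 r) (cong (s (reverse q) *_) (Comp12-sum c))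
  s-reverse-∷ {q = q} x c@(2∷_ {p = r} _) =
    trans (s-reverse-∷∷ x 2 r) (cong (s (reverse q) *_) (Comp12-sum c))

  !≡s[reverse]*gapProductʳ : ∀ {m p} → Comp12 (suc m) p → m ! ≡ s (reverse p) * gapProductʳ (suc m) p
  !≡s[reverse]*gapProductʳ (1∷ []) = refl
  !≡s[reverse]*gapProductʳ (1∷_ {suc m} {q} c) = begin
    suc m * m !
      ≡⟨ cong (suc m *_) (!≡s[reverse]*gapProductʳ c) ⟩
    suc m * (s (reverse q) * G)
      ≡⟨ ring (suc m) (s (reverse q)) G ⟩
    (s (reverse q) * suc m) * G
      ≡⟨ cong (_* G) (s-reverse-∷ 1 c) ⟨
    s (reverse (1 ∷ q)) * G ∎
    where
    G = gapProductʳ (suc m) q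
    ring : ∀ n S G → n * (S * G) ≡ (S * n) * G
    ring = solve-∀
  !≡s[reverse]*gapProductʳ (2∷ []) = refl
  !≡s[reverse]*gapProductʳ (2∷_ {suc m} {q} c) = begin
    suc (suc m) * (suc m * m !)
      ≡⟨ cong (λ x → suc (suc m) * (suc m * x)) (!≡s[reverse]*gapProductʳ c) ⟩
    suc (suc m) * (suc m * (s (reverse q) * G))
      ≡⟨ ring (suc (suc m)) (suc m) (s (reverse q)) G ⟩
    (s (reverse q) * suc m) * (suc (suc m) * G)
      ≡⟨ cong (_* (suc (suc m) * G)) (s-reverse-∷ 2 c) ⟨
    s (reverse (2 ∷ q)) * (suc (suc m) * G) ∎
    where
    G = gapProductʳ (suc m) q
    ring : ∀ n n′ S G → n * (n′ * (S * G)) ≡ (S * n′) * (n * G)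
    ring = solve-∀

open Compositions

module Polynomials where

  open import Data.Integer using (_+_; _*_)
  open import Data.Integer.Properties using (+-identityˡ; +-identityʳ; +-assoc; *-zeroʳ; *-distribˡ-+; pos-*)
  open import Data.Integer.Tactic.RingSolver using (solve-∀)
  open ≡-Reasoning

  -- Polynomials in t as integer coefficient sequences; shift is multiplication by t.
  Seq : Set
  Seq = ℕ → ℤ

  one : Seq
  one zero    = 1ℤ
  one (suc _) = 0ℤ

  shift : Seq → Seq
  shift f zero    = 0ℤ
  shift f (suc k) = f k

  infixl 6 _⊕_
  infixr 7 _⊛_

  _⊕_ : Seq → Seq → Seq
  (f ⊕ g) k = f k + g k

  _⊛_ : ℤ → Seq → Seq
  (c ⊛ f) k = c * f k

  shift-cong : ∀ {f g} → f ≗ g → shift f ≗ shift g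
  shift-cong f≗g zero    = refl
  shift-cong f≗g (suc k) = f≗g k

  shift-⊕ : ∀ f g → shift (f ⊕ g) ≗ shift f ⊕ shift g
  shift-⊕ f g zero    = refl
  shift-⊕ f g (suc k) = refl

  shift-⊛ : ∀ c f → shift (c ⊛ f) ≗ c ⊛ shift f
  shift-⊛ c f zero    = sym (*-zeroʳ c)
  shift-⊛ c f (suc k) = refl

  shift-⊕-⊛ : ∀ f c g → shift (f ⊕ c ⊛ g) ≗ shift f ⊕ c ⊛ shift g
  shift-⊕-⊛ f c g k = trans (shift-⊕ f (c ⊛ g) k) (cong (λ v → shift f k + v) (shift-⊛ c g k))

  -- M(a, m) of the proof idea.
  matchPoly : ℤ → ℕ → Seq
  matchPoly a zero          = one
  matchPoly a (suc zero)    = one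
  matchPoly a (suc (suc m)) =
    matchPoly (ℤ.suc a) (suc m) ⊕ (ℤ.suc a * + suc m) ⊛ shift (matchPoly (ℤ.suc (ℤ.suc a)) m)

  matchPoly-offset : ∀ a m →
    matchPoly (ℤ.suc (ℤ.suc a)) (suc (suc m)) ≗
    matchPoly a (suc (suc m)) ⊕ (+ suc (suc m) * + suc m) ⊛ shift (matchPoly (ℤ.suc (ℤ.suc a)) m)
  matchPoly-offset a zero k = ring a (one k) (shift one k)
    where
    ring : ∀ a x y →
      x + ((1ℤ + (1ℤ + (1ℤ + a))) * + 1) * y ≡ x + ((1ℤ + a) * + 1) * y + (+ 2 * + 1) * y
    ring = solve-∀
  matchPoly-offset a (suc zero) k = ring a (one k) (shift one k)
    where
    ring : ∀ a x y →
      x + ((1ℤ + (1ℤ + (1ℤ + (1ℤ + a)))) * + 1) * y + ((1ℤ + (1ℤ + (1ℤ + a))) * + 2) * y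
      ≡ x + ((1ℤ + (1ℤ + a)) * + 1) * y + ((1ℤ + a) * + 2) * y + (+ 3 * + 2) * y
    ring = solve-∀
  matchPoly-offset a (suc (suc m)) k = begin
    matchPoly a₃ (suc (suc (suc m))) k + w₂ * shift (matchPoly a₄ (suc (suc m))) k
      ≡⟨ cong₂ (λ u v → u + w₂ * v) (matchPoly-offset a₁ (suc m) k) (shift-cong (matchPoly-offset a₂ m) k) ⟩
    A + c₁ * B + w₂ * shift (matchPoly a₂ (suc (suc m)) ⊕ c₀ ⊛ E) k
      ≡⟨ cong (λ v → A + c₁ * B + w₂ * v) (shift-⊕-⊛ (matchPoly a₂ (suc (suc m))) c₀ E k) ⟩
    A + c₁ * B + w₂ * (C + c₀ * D)
      ≡⟨ cong (λ v → A + c₁ * B + w₂ * (v + c₀ * D)) C≡B+w₀D ⟩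
    A + c₁ * B + w₂ * ((B + w₀ * D) + c₀ * D)
      ≡⟨ ring a (+ m) A B D ⟩
    A + w * (B + w₀ * D) + c₂ * (B + w₀ * D)
      ≡⟨ cong (λ v → A + w * v + c₂ * v) (sym C≡B+w₀D) ⟩
    A + w * C + c₂ * C ∎
    where
    a₁ = ℤ.suc a
    a₂ = ℤ.suc a₁
    a₃ = ℤ.suc a₂
    a₄ = ℤ.suc a₃
    w  = a₁ * + suc (suc (suc m))
    w₀ = a₃ * + suc m
    w₂ = a₃ * + suc (suc (suc m))
    c₀ = + suc (suc m) * + suc m
    c₁ = + suc (suc (suc m)) * + suc (suc m)
    c₂ = + suc (suc (suc (suc m))) * + suc (suc (suc m))
    A = matchPoly a₁ (suc (suc (suc m))) k
    B = shift (matchPoly a₃ (suc m)) k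
    C = shift (matchPoly a₂ (suc (suc m))) k
    E = shift (matchPoly a₄ m)
    D = shift E k
    C≡B+w₀D : C ≡ B + w₀ * D
    C≡B+w₀D = shift-⊕-⊛ (matchPoly a₃ (suc m)) w₀ E k
    ring : ∀ a x A B D →
      let a₁ = 1ℤ + a ; a₃ = 1ℤ + (1ℤ + a₁) ; C = B + (a₃ * (+ 1 + x)) * D in
      A + ((+ 3 + x) * (+ 2 + x)) * B + (a₃ * (+ 3 + x)) * (C + ((+ 2 + x) * (+ 1 + x)) * D)
      ≡ A + (a₁ * (+ 3 + x)) * C + ((+ 4 + x) * (+ 3 + x)) * C
    ring = solve-∀

  matchPoly-minus-one : ∀ m → matchPoly -[1+ 0 ] (suc m) ≗ matchPoly 0ℤ m
  matchPoly-minus-one zero    k = refl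
  matchPoly-minus-one (suc m) k = +-identityʳ (matchPoly 0ℤ (suc m) k)

  matchPoly-zero-step : ∀ m →
    matchPoly 0ℤ (suc (suc m)) ≗ matchPoly 0ℤ m ⊕ (+ suc m * + suc m) ⊛ shift (matchPoly 0ℤ m)
  matchPoly-zero-step m k = begin
    matchPoly 0ℤ (suc (suc m)) k
      ≡⟨ matchPoly-offset -[1+ 1 ] m k ⟩
    matchPoly -[1+ 0 ] (suc m) k + w * S + c * S
      ≡⟨ cong (λ v → v + w * S + c * S) (matchPoly-minus-one m k) ⟩
    matchPoly 0ℤ m k + w * S + c * S
      ≡⟨ ring (+ m) (matchPoly 0ℤ m k) S ⟩
    matchPoly 0ℤ m k + (+ suc m * + suc m) * S ∎
    where
    w = -[1+ 0 ] * + suc m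
    c = + suc (suc m) * + suc m
    S = shift (matchPoly 0ℤ m) k
    ring : ∀ x P S →
      P + (-[1+ 0 ] * (+ 1 + x)) * S + ((+ 2 + x) * (+ 1 + x)) * S ≡ P + ((+ 1 + x) * (+ 1 + x)) * S
    ring = solve-∀

  ∏[1+k²t] : List ℕ → Seq
  ∏[1+k²t] []       = one
  ∏[1+k²t] (k ∷ ks) = ∏[1+k²t] ks ⊕ + (k ℕ.* k) ⊛ shift (∏[1+k²t] ks)

  matchPoly-zero≗∏ : ∀ m → matchPoly 0ℤ (suc m) ≗ ∏[1+k²t] (downBy2 m)
  matchPoly-zero≗∏ zero          k = refl
  matchPoly-zero≗∏ (suc zero)    k = refl
  matchPoly-zero≗∏ (suc (suc m)) k = begin
    matchPoly 0ℤ (suc (suc (suc m))) k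
      ≡⟨ matchPoly-zero-step (suc m) k ⟩
    matchPoly 0ℤ (suc m) k + c * shift (matchPoly 0ℤ (suc m)) k
      ≡⟨ cong₂ (λ u v → u + c * v) (matchPoly-zero≗∏ m k) (shift-cong (matchPoly-zero≗∏ m) k) ⟩
    P k + c * shift P k
      ≡⟨ cong (λ c → P k + c * shift P k) (pos-* (suc (suc m)) (suc (suc m))) ⟨
    ∏[1+k²t] (downBy2 (suc (suc m))) k ∎
    where
    c = + suc (suc m) * + suc (suc m)
    P = ∏[1+k²t] (downBy2 m)

  monomialSeq : ℤ → ℕ → Seq
  monomialSeq c zero    zero    = c
  monomialSeq c zero    (suc k) = 0ℤ
  monomialSeq c (suc d)         = shift (monomialSeq c d)

  monomialSeq-⊛ : ∀ c w d → c ⊛ monomialSeq w d ≗ monomialSeq (c * w) d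
  monomialSeq-⊛ c w zero    zero    = refl
  monomialSeq-⊛ c w zero    (suc k) = *-zeroʳ c
  monomialSeq-⊛ c w (suc d) zero    = *-zeroʳ c
  monomialSeq-⊛ c w (suc d) (suc k) = monomialSeq-⊛ c w d k

  sumSeq : List Seq → Seq
  sumSeq []       _ = 0ℤ
  sumSeq (f ∷ fs)   = f ⊕ sumSeq fs

  sumSeq-++ : ∀ fs gs → sumSeq (fs ++ gs) ≗ sumSeq fs ⊕ sumSeq gs
  sumSeq-++ []       gs k = sym (+-identityˡ (sumSeq gs k))
  sumSeq-++ (f ∷ fs) gs k =
    trans (cong (λ v → f k + v) (sumSeq-++ fs gs k)) (sym (+-assoc (f k) (sumSeq fs k) (sumSeq gs k)))

  sumSeq-map-cong : ∀ {A : Set} {f g : A → Seq} → (∀ x → f x ≗ g x) → ∀ xs → sumSeq (map f xs) ≗ sumSeq (map g xs)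
  sumSeq-map-cong f≗g []       k = refl
  sumSeq-map-cong f≗g (x ∷ xs) k = cong₂ _+_ (f≗g x k) (sumSeq-map-cong f≗g xs k)

  sumSeq-⊛-shift : ∀ {A : Set} c (f : A → Seq) xs →
    sumSeq (map (λ x → c ⊛ shift (f x)) xs) ≗ c ⊛ shift (sumSeq (map f xs))
  sumSeq-⊛-shift c f []       zero    = sym (*-zeroʳ c)
  sumSeq-⊛-shift c f []       (suc k) = sym (*-zeroʳ c)
  sumSeq-⊛-shift c f (x ∷ xs) k = begin
    c * shift (f x) k + sumSeq (map (λ x → c ⊛ shift (f x)) xs) k
      ≡⟨ cong (λ v → c * shift (f x) k + v) (sumSeq-⊛-shift c f xs k) ⟩
    c * shift (f x) k + c * shift (sumSeq (map f xs)) k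
      ≡⟨ sym (*-distribˡ-+ c _ _) ⟩
    c * (shift (f x) k + shift (sumSeq (map f xs)) k)
      ≡⟨ cong (c *_) (sym (shift-⊕ (f x) (sumSeq (map f xs)) k)) ⟩
    c * shift (sumSeq (f x ∷ map f xs)) k ∎

  compMonomial : ℕ → ℕ → List ℕ → Seq
  compMonomial a m p = monomialSeq (+ (gapProduct a p ℕ.* gapProductʳ m p)) (twos p)

  compMonomial-2∷ : ∀ a m q →
    compMonomial a (suc (suc m)) (2 ∷ q) ≗ (+ suc a * + suc m) ⊛ shift (compMonomial (suc (suc a)) m q)
  compMonomial-2∷ a m q k = begin
    shift (monomialSeq (+ ((suc a ℕ.* G) ℕ.* (suc m ℕ.* H))) (twos q)) k
      ≡⟨ cong (λ w → shift (monomialSeq w (twos q)) k) weight ⟩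
    shift (monomialSeq (c * + (G ℕ.* H)) (twos q)) k
      ≡⟨ shift-cong (monomialSeq-⊛ c (+ (G ℕ.* H)) (twos q)) k ⟨
    shift (c ⊛ monomialSeq (+ (G ℕ.* H)) (twos q)) k
      ≡⟨ shift-⊛ c (monomialSeq (+ (G ℕ.* H)) (twos q)) k ⟩
    c * shift (compMonomial (suc (suc a)) m q) k ∎
    where
    c = + suc a * + suc m
    G = gapProduct (suc (suc a)) q
    H = gapProductʳ m q
    weight : + ((suc a ℕ.* G) ℕ.* (suc m ℕ.* H)) ≡ c * + (G ℕ.* H)
    weight = trans (cong +_ (ℕ.[m*n]*[o*p]≡[m*o]*[n*p] (suc a) G (suc m) H)) (pos-* (suc a ℕ.* suc m) (G ℕ.* H))

  matchPoly-comps12 : ∀ a m → matchPoly (+ a) m ≗ sumSeq (map (compMonomial a m) (comps12 m))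
  matchPoly-comps12 a zero          zero    = refl
  matchPoly-comps12 a zero          (suc k) = refl
  matchPoly-comps12 a (suc zero)    zero    = refl
  matchPoly-comps12 a (suc zero)    (suc k) = refl
  matchPoly-comps12 a (suc (suc m)) k = begin
    matchPoly (+ suc a) (suc m) k + c * shift (matchPoly (+ suc (suc a)) m) k
      ≡⟨ cong₂ (λ u v → u + c * v) (matchPoly-comps12 (suc a) (suc m) k)
                                   (shift-cong (matchPoly-comps12 (suc (suc a)) m) k) ⟩
    S₁ + c * shift (sumSeq (map G L₂)) k
      ≡⟨ cong (λ v → S₁ + v) (sumSeq-⊛-shift c G L₂ k) ⟨
    S₁ + sumSeq (map (λ q → c ⊛ shift (G q)) L₂) k
      ≡⟨ cong (λ v → S₁ + v) (sumSeq-map-cong (λ q → compMonomial-2∷ a m q) L₂ k) ⟨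
    S₁ + sumSeq (map (F ∘ (2 ∷_)) L₂) k
      ≡⟨ cong₂ (λ u v → sumSeq u k + sumSeq v k) (map-∘ L₁) (map-∘ L₂) ⟩
    sumSeq (map F (map (1 ∷_) L₁)) k + sumSeq (map F (map (2 ∷_) L₂)) k
      ≡⟨ sumSeq-++ (map F (map (1 ∷_) L₁)) (map F (map (2 ∷_) L₂)) k ⟨
    sumSeq (map F (map (1 ∷_) L₁) ++ map F (map (2 ∷_) L₂)) k
      ≡⟨ cong (λ l → sumSeq l k) (map-++ F (map (1 ∷_) L₁) (map (2 ∷_) L₂)) ⟨
    sumSeq (map F (comps12 (suc (suc m)))) k ∎
    where
    c  = + suc a * + suc m
    F  = compMonomial a (suc (suc m))
    G  = compMonomial (suc (suc a)) m
    L₁ = comps12 (suc m)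
    L₂ = comps12 m
    S₁ = sumSeq (map (F ∘ (1 ∷_)) L₁) k

open Polynomials

module Coefficients where

  open import Data.Nat using (_!; _∸_)
  open import Data.Integer.Tactic.RingSolver using (solve-∀)

  ι : ℤ → ℚ
  ι z = z / 1

  toℚᵘ-ι : ∀ z → toℚᵘ (ι z) ≃ᵘ mkℚᵘ z 0
  toℚᵘ-ι z = ℚ.toℚᵘ-fromℚᵘ (mkℚᵘ z 0)

  ι-+ : ∀ x y → ι (x ℤ.+ y) ≡ ι x +ℚ ι y
  ι-+ x y = ℚ.toℚᵘ-injective (begin
    toℚᵘ (ι (x ℤ.+ y))           ≈⟨ toℚᵘ-ι (x ℤ.+ y) ⟩
    mkℚᵘ (x ℤ.+ y) 0             ≈⟨ *≡* (ring x y) ⟩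
    mkℚᵘ x 0 +ᵘ mkℚᵘ y 0          ≈⟨ ℚᵘ.+-cong (toℚᵘ-ι x) (toℚᵘ-ι y) ⟨
    toℚᵘ (ι x) +ᵘ toℚᵘ (ι y)      ≈⟨ ℚ.toℚᵘ-homo-+ (ι x) (ι y) ⟨
    toℚᵘ (ι x +ℚ ι y)            ∎)
    where
    open ℚᵘ.≃-Reasoning
    ring : ∀ x y → (x ℤ.+ y) ℤ.* (+ 1 ℤ.* + 1) ≡ (x ℤ.* + 1 ℤ.+ y ℤ.* + 1) ℤ.* + 1
    ring = solve-∀

  ι-* : ∀ x y → ι (x ℤ.* y) ≡ ι x *ℚ ι y
  ι-* x y = ℚ.toℚᵘ-injective (begin
    toℚᵘ (ι (x ℤ.* y))           ≈⟨ toℚᵘ-ι (x ℤ.* y) ⟩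
    mkℚᵘ (x ℤ.* y) 0             ≈⟨ *≡* (ring x y) ⟩
    mkℚᵘ x 0 *ᵘ mkℚᵘ y 0          ≈⟨ ℚᵘ.*-cong (toℚᵘ-ι x) (toℚᵘ-ι y) ⟨
    toℚᵘ (ι x) *ᵘ toℚᵘ (ι y)      ≈⟨ ℚ.toℚᵘ-homo-* (ι x) (ι y) ⟨
    toℚᵘ (ι x *ℚ ι y)            ∎)
    where
    open ℚᵘ.≃-Reasoning
    ring : ∀ x y → (x ℤ.* y) ℤ.* (+ 1 ℤ.* + 1) ≡ (x ℤ.* y) ℤ.* + 1
    ring = solve-∀

  frac-≡ : ∀ {x} d w → .{{ℕ.NonZero x}} → x ≡ d ℕ.* w → frac x d ≡ ι (+ w)
  frac-≡ zero    w refl = ⊥-elim (ℕ.≢-nonZero⁻¹ 0 refl)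
  frac-≡ (suc d) w refl = ℚ.fromℚᵘ-cong {mkℚᵘ (+ (suc d ℕ.* w)) d} {mkℚᵘ (+ w) 0}
    (*≡* (trans (cong (ℤ._* + 1) (ℤ.pos-* (suc d) w)) (ring (+ suc d) (+ w))))
    where
    ring : ∀ d w → (d ℤ.* w) ℤ.* + 1 ≡ w ℤ.* d
    ring = solve-∀

  coeff-+P : ∀ p q k → coeff (p +P q) k ≡ coeff p k +ℚ coeff q k
  coeff-+P []       q        k       = sym (ℚ.+-identityˡ (coeff q k))
  coeff-+P (c ∷ cs) []       k       = sym (ℚ.+-identityʳ (coeff (c ∷ cs) k))
  coeff-+P (c ∷ cs) (d ∷ ds) zero    = refl
  coeff-+P (c ∷ cs) (d ∷ ds) (suc k) = coeff-+P cs ds k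

  coeff-scaleP : ∀ a p k → coeff (scaleP a p) k ≡ a *ℚ coeff p k
  coeff-scaleP a []       k       = sym (ℚ.*-zeroʳ a)
  coeff-scaleP a (c ∷ cs) zero    = refl
  coeff-scaleP a (c ∷ cs) (suc k) = coeff-scaleP a cs k

  coeff-*P-∷ : ∀ a p q k → coeff ((a ∷ p) *P q) k ≡ a *ℚ coeff q k +ℚ coeff (0ℚ ∷ (p *P q)) k
  coeff-*P-∷ a p q k =
    trans (coeff-+P (scaleP a q) (0ℚ ∷ (p *P q)) k) (cong (_+ℚ coeff (0ℚ ∷ (p *P q)) k) (coeff-scaleP a q k))

  coeff-[1+bt]*P : ∀ b q k → coeff ((1ℚ ∷ [ b ]) *P q) k ≡ coeff q k +ℚ b *ℚ coeff (0ℚ ∷ q) k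
  coeff-[1+bt]*P b q k =
    trans (coeff-*P-∷ 1ℚ [ b ] q k) (cong₂ _+ℚ_ (ℚ.*-identityˡ (coeff q k)) (bt*P k))
    where
    bt*P : ∀ k → coeff (0ℚ ∷ ([ b ] *P q)) k ≡ b *ℚ coeff (0ℚ ∷ q) k
    bt*P zero          = sym (ℚ.*-zeroʳ b)
    bt*P (suc zero)    = trans (coeff-*P-∷ b [] q zero) (ℚ.+-identityʳ (b *ℚ coeff q zero))
    bt*P (suc (suc k)) = trans (coeff-*P-∷ b [] q (suc k)) (ℚ.+-identityʳ (b *ℚ coeff q (suc k)))

  coeff-0∷ : ∀ {q f} → coeff q ≗ ι ∘ f → coeff (0ℚ ∷ q) ≗ ι ∘ shift f
  coeff-0∷ q≗f zero    = refl
  coeff-0∷ q≗f (suc k) = q≗f k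

  coeff-rhs : ∀ ks → coeff (prodP (map (λ k → 1ℚ ∷ [ (+ (k ℕ.* k)) / 1 ]) ks)) ≗ ι ∘ ∏[1+k²t] ks
  coeff-rhs []       zero    = refl
  coeff-rhs []       (suc i) = refl
  coeff-rhs (k ∷ ks) i = begin
    coeff ((1ℚ ∷ [ ι k² ]) *P q) i
      ≡⟨ coeff-[1+bt]*P (ι k²) q i ⟩
    coeff q i +ℚ ι k² *ℚ coeff (0ℚ ∷ q) i
      ≡⟨ cong₂ (λ u v → u +ℚ ι k² *ℚ v) (coeff-rhs ks i) (coeff-0∷ (coeff-rhs ks) i) ⟩
    ι (P i) +ℚ ι k² *ℚ ι (shift P i)
      ≡⟨ cong (ι (P i) +ℚ_) (ι-* k² (shift P i)) ⟨
    ι (P i) +ℚ ι (k² ℤ.* shift P i)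
      ≡⟨ ι-+ (P i) (k² ℤ.* shift P i) ⟨
    ι (∏[1+k²t] (k ∷ ks) i) ∎
    where
    open ≡-Reasoning
    k² = + (k ℕ.* k)
    q  = prodP (map (λ k → 1ℚ ∷ [ (+ (k ℕ.* k)) / 1 ]) ks)
    P  = ∏[1+k²t] ks

  coeff-monomial : ∀ c d → coeff (monomial (ι c) d) ≗ ι ∘ monomialSeq c d
  coeff-monomial c zero    zero    = refl
  coeff-monomial c zero    (suc k) = refl
  coeff-monomial c (suc d) zero    = refl
  coeff-monomial c (suc d) (suc k) = coeff-monomial c d k

  coeff-sumP-map : ∀ {A : Set} {g : A → Poly} {G : A → Seq} {xs} →
    All (λ x → coeff (g x) ≗ ι ∘ G x) xs → coeff (sumP (map g xs)) ≗ ι ∘ sumSeq (map G xs)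
  coeff-sumP-map []                    k = refl
  coeff-sumP-map {g = g} {G} {x ∷ xs} (gx≗Gx ∷ rest) k = begin
    coeff (g x +P sumP (map g xs)) k
      ≡⟨ coeff-+P (g x) (sumP (map g xs)) k ⟩
    coeff (g x) k +ℚ coeff (sumP (map g xs)) k
      ≡⟨ cong₂ _+ℚ_ (gx≗Gx k) (coeff-sumP-map rest k) ⟩
    ι (G x k) +ℚ ι (sumSeq (map G xs) k)
      ≡⟨ ι-+ (G x k) (sumSeq (map G xs) k) ⟨
    ι (sumSeq (map G (x ∷ xs)) k) ∎
    where open ≡-Reasoning

  coeff-summand : ∀ {m p} → Comp12 (suc m) p →
    coeff (monomial (frac (m !) (s p) *ℚ frac (m !) (s (reverse p))) (suc m ∸ length p))
      ≗ ι ∘ compMonomial 0 (suc m) p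
  coeff-summand {m} {p} c k = begin
    coeff (monomial (frac (m !) (s p) *ℚ frac (m !) (s (reverse p))) (suc m ∸ length p)) k
      ≡⟨ cong₂ (λ a d → coeff (monomial a d) k) weight (Comp12-∸length≡twos c) ⟩
    coeff (monomial (ι (+ (G ℕ.* H))) (twos p)) k
      ≡⟨ coeff-monomial (+ (G ℕ.* H)) (twos p) k ⟩
    ι (compMonomial 0 (suc m) p k) ∎
    where
    open ≡-Reasoning
    G = gapProduct 0 p
    H = gapProductʳ (suc m) p
    instance
      m!≢0 = m ℕ.!≢0
    weight : frac (m !) (s p) *ℚ frac (m !) (s (reverse p)) ≡ ι (+ (G ℕ.* H))
    weight = begin
      frac (m !) (s p) *ℚ frac (m !) (s (reverse p))
        ≡⟨ cong₂ _*ℚ_ (frac-≡ (s p) G (!≡s*gapProduct c))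
                      (frac-≡ (s (reverse p)) H (!≡s[reverse]*gapProductʳ c)) ⟩
      ι (+ G) *ℚ ι (+ H)   ≡⟨ ι-* (+ G) (+ H) ⟨
      ι (+ G ℤ.* + H)      ≡⟨ cong ι (ℤ.pos-* G H) ⟨
      ι (+ (G ℕ.* H))      ∎

  coeff-lhs : ∀ m → coeff (lhs (suc m)) ≗ ι ∘ matchPoly 0ℤ (suc m)
  coeff-lhs m k = trans (coeff-sumP-map (All.map coeff-summand (comps12-sound (suc m))) k)
                        (cong ι (sym (matchPoly-comps12 0 (suc m) k)))

open Coefficients

proposition7 : (n : ℕ) → 1 ≤ n → (m : ℕ) → coeff (lhs n) m ≡ coeff (rhs n) m
proposition7 zero    ()
proposition7 (suc n) _ k = begin
  coeff (lhs (suc n)) k              ≡⟨ coeff-lhs n k ⟩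
  ι (matchPoly 0ℤ (suc n) k)         ≡⟨ cong ι (matchPoly-zero≗∏ n k) ⟩
  ι (∏[1+k²t] (downBy2 n) k)         ≡⟨ coeff-rhs (downBy2 n) k ⟨
  coeff (rhs (suc n)) k              ∎
  where open ≡-Reasoning
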